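{- For integers $m\ge 0$ and $i$, let \[ d_i(m)=2^{ -2m}\sum_{k=i}^{m}2^k\binom{2m-2k}{m-k}\binom{m+k}{k}\binom{k}{i}, \] with the convention that $d_i(m)=0$ when $i<0$ or $i>m$. Then for every integer $m\ge 2$ and every $i$ with $0\le i\le m$, \[ d_i(m)\,d_{i+1}(m+1)>d_{i+1}(m)\,d_i(m+1) \] and \[ d_i(m)\,d_i(m+1)>d_{i-1}(m)\,d_{i+1}(m+1). \]
   Context: For $0\le i\le m$, $d_i(m)$ is the coefficient of $x^i$ in the Boros–Moll polynomial $P_m(x)=\sum_{j,k}\binom{2m+1}{2j}\binom{m-j}{k}\binom{2k+2j}{k+j}\frac{(x+1)^j(x-1)^k}{2^{3(k+j)}}$; these coefficients are positive. Together the two inequalities say that the ratios $r_i(m)=d_i(m)/d_{i+1}(m)$ interlace the ratios $r_i(m+1)$, i.e. $r_0(m+1)\le r_0(m)\le r_1(m+1)\le r_1(m)\le\cdots\le r_{m-1}(m+1)\le r_{m-1}(m)\le r_m(m+1)$ (the Boros–Moll polynomials are "interlacing log-concave"). -}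

module Defs where

open import Data.Nat as ℕ using (ℕ; zero; suc; _+_; _∸_)
open import Data.Nat.Combinatorics using (_C_)
open import Data.Integer as ℤ using (ℤ; +_; -[1+_])
open import Data.List using (List; map; upTo)
open import Data.Nat.ListAction using (sum)
open import Data.Rational as ℚ using (ℚ; _/_; 0ℚ; 1ℚ)

-- sum_{k = a}^{b} f k  (empty, i.e. 0, when a > b)
sumFromTo : ℕ → ℕ → (ℕ → ℕ) → ℕ
sumFromTo a b f = sum (map (λ j → f (a + j)) (upTo (suc b ∸ a)))

-- 2^{-2m} = (1/4)^m as a rational
quarterPow : ℕ → ℚ
quarterPow zero    = 1ℚ
quarterPow (suc m) = (+ 1 / 4) ℚ.* quarterPow m

D : ℕ → ℕ → ℕ
D i m = sumFromTo i m (λ k → (2 ℕ.^ k) ℕ.* ((2 ℕ.* m ∸ 2 ℕ.* k) C (m ∸ k))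
                                       ℕ.* ((m + k) C k) ℕ.* (k C i))

-- d_i(m) = 2^{-2m} D i m, for an integer index i; 0 for i < 0
-- (for i > m the sum is empty, so d_i(m) = 0 automatically)
d : ℤ → ℕ → ℚ
d (+ i)    m = ((+ D i m) / 1) ℚ.* quarterPow m
d -[1+ _ ] m = 0ℚ

module Submission where

-- Write S i m = Σ_{k ≤ m} c k m · C(k, i) with c k m = 2^k C(2m-2k, m-k) C(m+k, k),
-- so that D i m = S i m and d_i(m) = 4^{-m} · S i m.  Everything up to the last
-- step is about natural numbers:
--   * binomial identities give recurrences for the weights c k m in k and in m
--     (Binomial, Weights); summing them gives a two-term recurrence of S in m
--     and a three-term recurrence of S in i (Sums);
--   * running the three-term recurrence downward from S_{m+1}(m) = 0 bounds the
--     ratio S_{i+1}(m) / S_i(m) from above (RatioBound);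
--   * at an interior index, eliminating row m+1 and S_i(m) with the recurrences
--     turns both inequalities into comparisons of binary quadratic forms in
--     (S_{i+1}(m), S_{i+2}(m)) on the cone given by the ratio bound
--     (QuadraticForms); these reduce to polynomial inequalities in two
--     variables, checked coefficientwise by a certified normalizer (Polynomials);
--   * the boundary indices are direct (Inequalities), and the rescaling by
--     4^{-m} carries the result over to the rationals d_i(m) (Rationals).

module Arithmetic where

  open import Data.Nat
  open import Data.Nat.Properties
  open import Relation.Binary.PropositionalEquality

  -- Deriving an identity from hypotheses: if L + K' = R + K is a polynomial
  -- identity and the hypotheses give K = K', then L = R.
  combine : ∀ {L R K K'} → L + K' ≡ R + K → K ≡ K' → L ≡ R
  combine {L} {R} {K} {K'} identity K≡K' =
    +-cancelʳ-≡ K' L R (trans identity (cong (R +_) K≡K'))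

  *-pos : ∀ {a b} → 0 < a → 0 < b → 0 < a * b
  *-pos = *-mono-<

module FiniteSums where

  open import Data.Nat
  open import Data.Nat.Properties
  open import Data.List using (map; applyUpTo)
  open import Data.Nat.ListAction using (sum)
  open import Function using (_∘_)
  open import Data.Nat.Tactic.RingSolver using (solve-∀)
  open import Relation.Binary.PropositionalEquality
  open import Algebra.Properties.CommutativeSemigroup +-commutativeSemigroup
    using () renaming (interchange to +-interchange)

  -- ∑ n f = f 0 + f 1 + ⋯ + f (n - 1), recursing on the front so that
  -- reindexing k ↦ suc k is definitional.
  ∑ : ℕ → (ℕ → ℕ) → ℕ
  ∑ zero    f = 0
  ∑ (suc n) f = f 0 + ∑ n (f ∘ suc)

  sum-applyUpTo : ∀ n (f g : ℕ → ℕ) → sum (map g (applyUpTo f n)) ≡ ∑ n (g ∘ f)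
  sum-applyUpTo zero    f g = refl
  sum-applyUpTo (suc n) f g = cong (g (f 0) +_) (sum-applyUpTo n (f ∘ suc) g)

  ∑-cong : ∀ n {f g : ℕ → ℕ} → (∀ k → k < n → f k ≡ g k) → ∑ n f ≡ ∑ n g
  ∑-cong zero    f≡g = refl
  ∑-cong (suc n) f≡g =
    cong₂ _+_ (f≡g 0 z<s) (∑-cong n (λ k k<n → f≡g (suc k) (s<s k<n)))

  ∑-+ : ∀ n (f g : ℕ → ℕ) → ∑ n (λ k → f k + g k) ≡ ∑ n f + ∑ n g
  ∑-+ zero    f g = refl
  ∑-+ (suc n) f g =
    trans (cong (f 0 + g 0 +_) (∑-+ n (f ∘ suc) (g ∘ suc))) (+-interchange (f 0) (g 0) _ _)

  ∑-*ˡ : ∀ n a (f : ℕ → ℕ) → ∑ n (λ k → a * f k) ≡ a * ∑ n f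
  ∑-*ˡ zero    a f = sym (*-zeroʳ a)
  ∑-*ˡ (suc n) a f =
    trans (cong (a * f 0 +_) (∑-*ˡ n a (f ∘ suc))) (sym (*-distribˡ-+ a (f 0) _))

  ∑-linear : ∀ n a b (f g : ℕ → ℕ) →
    ∑ n (λ k → a * f k + b * g k) ≡ a * ∑ n f + b * ∑ n g
  ∑-linear n a b f g =
    trans (∑-+ n (λ k → a * f k) (λ k → b * g k)) (cong₂ _+_ (∑-*ˡ n a f) (∑-*ˡ n b g))

  ∑-snoc : ∀ n (f : ℕ → ℕ) → ∑ (suc n) f ≡ ∑ n f + f n
  ∑-snoc zero    f = +-comm (f 0) 0
  ∑-snoc (suc n) f =
    trans (cong (f 0 +_) (∑-snoc n (f ∘ suc))) (sym (+-assoc (f 0) _ _))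

  ∑-zero : ∀ n (f : ℕ → ℕ) → (∀ k → k < n → f k ≡ 0) → ∑ n f ≡ 0
  ∑-zero zero    f f≡0 = refl
  ∑-zero (suc n) f f≡0 =
    cong₂ _+_ (f≡0 0 z<s) (∑-zero n (f ∘ suc) (λ k k<n → f≡0 (suc k) (s<s k<n)))

  ∑-dropZeros : ∀ i n (f : ℕ → ℕ) → (∀ k → k < i → f k ≡ 0) →
    ∑ n f ≡ ∑ (n ∸ i) (λ j → f (i + j))
  ∑-dropZeros zero    n       f f≡0 = refl
  ∑-dropZeros (suc i) zero    f f≡0 = refl
  ∑-dropZeros (suc i) (suc n) f f≡0 rewrite f≡0 0 z<s =
    ∑-dropZeros i n (f ∘ suc) (λ k k<i → f≡0 (suc k) (s<s k<i))

  last≤∑ : ∀ n (f : ℕ → ℕ) → f n ≤ ∑ (suc n) f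
  last≤∑ n f rewrite ∑-snoc n f = m≤n+m (f n) (∑ n f)

  ∑-split : ∀ n (G α β : ℕ → ℕ) →
    G 0 ≡ β 0 → (∀ k → k < n → G (suc k) ≡ α k + β (suc k)) → G (suc n) ≡ α n →
    ∑ (suc (suc n)) G ≡ ∑ (suc n) α + ∑ (suc n) β
  ∑-split n G α β G₀ Gₛ Gₙ =
    begin
      ∑ (suc (suc n)) G                    ≡⟨ ∑-snoc (suc n) G ⟩
      ∑ (suc n) G + G (suc n)              ≡⟨ cong₂ _+_ (interior n Gₛ) Gₙ ⟩
      ∑ n α + ∑ (suc n) β + α n            ≡⟨ +-comm-last (∑ n α) (∑ (suc n) β) (α n) ⟩
      (∑ n α + α n) + ∑ (suc n) β          ≡⟨ cong (_+ ∑ (suc n) β) (∑-snoc n α) ⟨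
      ∑ (suc n) α + ∑ (suc n) β            ∎
    where
    open ≡-Reasoning
    +-comm-last : ∀ a b c → a + b + c ≡ a + c + b
    +-comm-last a b c = trans (+-assoc a b c) (trans (cong (a +_) (+-comm b c)) (sym (+-assoc a c b)))
    interior : ∀ j → (∀ k → k < j → G (suc k) ≡ α k + β (suc k)) →
      ∑ (suc j) G ≡ ∑ j α + ∑ (suc j) β
    interior zero    _  = cong (_+ 0) G₀
    interior (suc j) Gₛ' = begin
      ∑ (suc (suc j)) G                        ≡⟨ ∑-snoc (suc j) G ⟩
      ∑ (suc j) G + G (suc j)                  ≡⟨ cong₂ _+_ (interior j (λ k k<j → Gₛ' k (m<n⇒m<1+n k<j)))
                                                            (Gₛ' j ≤-refl) ⟩
      ∑ j α + ∑ (suc j) β + (α j + β (suc j))  ≡⟨ +-interchange (∑ j α) _ (α j) _ ⟩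
      (∑ j α + α j) + (∑ (suc j) β + β (suc j)) ≡⟨ cong₂ _+_ (∑-snoc j α) (∑-snoc (suc j) β) ⟨
      ∑ (suc j) α + ∑ (suc (suc j)) β          ∎

  ∑-shift : ∀ n (F G : ℕ → ℕ) →
    F 0 ≡ 0 → (∀ k → k < n → F (suc k) ≡ G k) → G n ≡ 0 →
    ∑ (suc n) F ≡ ∑ (suc n) G
  ∑-shift n F G F₀ Fₛ Gₙ = begin
    F 0 + ∑ n (F ∘ suc)   ≡⟨ cong₂ _+_ F₀ (∑-cong n Fₛ) ⟩
    ∑ n G                 ≡⟨ +-identityʳ (∑ n G) ⟨
    ∑ n G + 0             ≡⟨ cong (∑ n G +_) Gₙ ⟨
    ∑ n G + G n           ≡⟨ ∑-snoc n G ⟨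
    ∑ (suc n) G           ∎
    where open ≡-Reasoning

  ∑-combination : ∀ n a b (y u v w : ℕ → ℕ) →
    ∑ n (λ k → y k * (a * u k + b * v k + w k))
    ≡ a * ∑ n (λ k → y k * u k) + b * ∑ n (λ k → y k * v k) + ∑ n (λ k → y k * w k)
  ∑-combination n a b y u v w = begin
    ∑ n (λ k → y k * (a * u k + b * v k + w k))
      ≡⟨ ∑-cong n (λ k _ → distribute (y k) (u k) (v k) (w k) a b) ⟩
    ∑ n (λ k → (a * (y k * u k) + b * (y k * v k)) + y k * w k)
      ≡⟨ ∑-+ n (λ k → a * (y k * u k) + b * (y k * v k)) (λ k → y k * w k) ⟩
    ∑ n (λ k → a * (y k * u k) + b * (y k * v k)) + ∑ n (λ k → y k * w k)
      ≡⟨ cong (_+ ∑ n (λ k → y k * w k)) (∑-linear n a b (λ k → y k * u k) (λ k → y k * v k)) ⟩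
    a * ∑ n (λ k → y k * u k) + b * ∑ n (λ k → y k * v k) + ∑ n (λ k → y k * w k)
      ∎
    where
    open ≡-Reasoning
    distribute : ∀ y u v w a b → y * (a * u + b * v + w) ≡ a * (y * u) + b * (y * v) + y * w
    distribute = solve-∀

module Binomial where

  open import Data.Nat
  open import Data.Nat.Properties
  open import Data.Nat.Combinatorics
  open import Data.Nat.Tactic.RingSolver using (solve-∀)
  open import Relation.Binary.PropositionalEquality
  open ≡-Reasoning

  pascal : ∀ n k → suc n C suc k ≡ n C k + n C suc k
  pascal n k = sym (nCk+nC[k+1]≡[n+1]C[k+1] n k)

  C-pos : ∀ n k → k ≤ n → 0 < n C k
  C-pos n       zero    _         = z<s
  C-pos (suc n) (suc k) (s≤s k≤n) rewrite pascal n k = <-≤-trans (C-pos n k k≤n) (m≤m+n _ _)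

  C-sym : ∀ a b → (a + b) C a ≡ (a + b) C b
  C-sym a b = trans (nCk≡nC[n∸k] (m≤m+n a b)) (cong ((a + b) C_) (m+n∸m≡n a b))

  absorb : ∀ n k → suc k * (suc n C suc k) ≡ suc n * (n C k)
  absorb zero    zero    = refl
  absorb zero    (suc k) = *-zeroʳ (suc (suc k))
  absorb (suc n) zero    = trans (+-identityʳ _) (trans (nC1≡n (suc (suc n))) (cong suc (sym (*-identityʳ (suc n)))))
  absorb (suc n) (suc k) = begin
    suc (suc k) * (suc (suc n) C suc (suc k))
      ≡⟨ cong (suc (suc k) *_) (pascal (suc n) (suc k)) ⟩
    suc (suc k) * (A + B)
      ≡⟨ expand k A B ⟩
    suc k * A + A + suc (suc k) * B
      ≡⟨ cong₂ (λ a b → a + A + b) (absorb n k) (absorb n (suc k)) ⟩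
    suc n * (n C k) + A + suc n * (n C suc k)
      ≡⟨ collect (suc n) (n C k) (n C suc k) A ⟩
    suc n * (n C k + n C suc k) + A
      ≡⟨ cong (λ a → suc n * a + A) (pascal n k) ⟨
    suc n * A + A
      ≡⟨ +-comm (suc n * A) A ⟩
    suc (suc n) * A
      ∎
    where
    A B : ℕ
    A = suc n C suc k
    B = suc n C suc (suc k)
    expand : ∀ k a b → suc (suc k) * (a + b) ≡ suc k * a + a + suc (suc k) * b
    expand = solve-∀
    collect : ∀ p x y z → p * x + z + p * y ≡ p * (x + y) + z
    collect = solve-∀

  weighted : ∀ k j → k * (k C j) ≡ j * (k C j) + suc j * (k C suc j)
  weighted zero    zero    = refl
  weighted zero    (suc j) = sym (cong₂ _+_ (*-zeroʳ (suc j)) (*-zeroʳ (suc (suc j))))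
  weighted (suc k) zero    = trans (*-identityʳ (suc k)) (sym (trans (+-identityʳ _) (nC1≡n (suc k))))
  weighted (suc k) (suc j) = begin
    suc k * (suc k C suc j)                          ≡⟨ cong (suc k *_) (pascal k j) ⟩
    suc k * (k C j + k C suc j)                      ≡⟨ *-distribˡ-+ (suc k) (k C j) _ ⟩
    suc k * (k C j) + suc k * (k C suc j)            ≡⟨ cong₂ _+_ (absorb k j) (absorb k (suc j)) ⟨
    suc j * (suc k C suc j) + suc (suc j) * (suc k C suc (suc j)) ∎

  absorb-pred : ∀ k j → k * ((k ∸ 1) C j) ≡ suc j * (k C suc j)
  absorb-pred zero    j = sym (*-zeroʳ (suc j))
  absorb-pred (suc k) j = sym (absorb k j)

  central : ∀ n → suc n * ((suc n + suc n) C suc n) ≡ 2 * suc (n + n) * ((n + n) C n)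
  central n = begin
    suc n * ((suc n + suc n) C suc n)            ≡⟨ cong (λ t → suc n * (suc t C suc n)) (+-suc n n) ⟩
    suc n * (suc (suc (n + n)) C suc n)          ≡⟨ cong (suc n *_) (pascal (suc (n + n)) n) ⟩
    suc n * (suc (n + n) C n + suc (n + n) C suc n)
      ≡⟨ cong (λ t → suc n * (t + suc (n + n) C suc n)) middle ⟩
    suc n * (suc (n + n) C suc n + suc (n + n) C suc n)
      ≡⟨ double (suc n) (suc (n + n) C suc n) ⟩
    2 * (suc n * (suc (n + n) C suc n))          ≡⟨ cong (2 *_) (absorb (n + n) n) ⟩
    2 * (suc (n + n) * ((n + n) C n))            ≡⟨ *-assoc 2 (suc (n + n)) _ ⟨
    2 * suc (n + n) * ((n + n) C n)              ∎
    where
    double : ∀ a x → a * (x + x) ≡ 2 * (a * x)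
    double = solve-∀
    middle : suc (n + n) C n ≡ suc (n + n) C suc n
    middle = begin
      suc (n + n) C n        ≡⟨ cong (_C n) (+-suc n n) ⟨
      (n + suc n) C n        ≡⟨ C-sym n (suc n) ⟩
      (n + suc n) C suc n    ≡⟨ cong (_C suc n) (+-suc n n) ⟩
      suc (n + n) C suc n    ∎

  absorb-co : ∀ j r → suc r * (suc (j + r) C j) ≡ suc (j + r) * ((j + r) C j)
  absorb-co j r = begin
    suc r * (suc (j + r) C j)       ≡⟨ cong (λ t → suc r * (t C j)) (+-suc j r) ⟨
    suc r * ((j + suc r) C j)       ≡⟨ cong (suc r *_) (C-sym j (suc r)) ⟩
    suc r * ((j + suc r) C suc r)   ≡⟨ cong (λ t → suc r * (t C suc r)) (+-suc j r) ⟩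
    suc r * (suc (j + r) C suc r)   ≡⟨ absorb (j + r) r ⟩
    suc (j + r) * ((j + r) C r)     ≡⟨ cong (suc (j + r) *_) (C-sym j r) ⟨
    suc (j + r) * ((j + r) C j)     ∎

module Weights where

  open import Data.Nat
  open import Data.Nat.Properties
  open import Data.Nat.Combinatorics
  open import Data.Nat.Tactic.RingSolver using (solve-∀)
  open import Data.Product using (_,_)
  open import Relation.Binary.PropositionalEquality
  open ≡-Reasoning
  open Binomial

  c : ℕ → ℕ → ℕ
  c k m = 2 ^ k * ((2 * m ∸ 2 * k) C (m ∸ k)) * ((m + k) C k)

  -- The same weight, parametrised by k and n = m - k (free of truncated subtraction).
  a : ℕ → ℕ → ℕ
  a k n = 2 ^ k * ((n + n) C n) * ((k + n + k) C k)

  c≡a : ∀ k n → c k (k + n) ≡ a k n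
  c≡a k n = cong₂ (λ t u → 2 ^ k * (t C u) * ((k + n + k) C k)) twice (m+n∸m≡n k n)
    where
    twice : 2 * (k + n) ∸ 2 * k ≡ n + n
    twice = begin
      2 * (k + n) ∸ 2 * k       ≡⟨ cong (_∸ 2 * k) (*-distribˡ-+ 2 k n) ⟩
      2 * k + 2 * n ∸ 2 * k     ≡⟨ m+n∸m≡n (2 * k) (2 * n) ⟩
      2 * n                     ≡⟨ cong (n +_) (+-identityʳ n) ⟩
      n + n                     ∎

  -- 2k + n + 2 written in the two ways the binomial tops occur below.
  shape : ∀ k n → suc k + n + suc k ≡ suc (k + suc n + k)
  shape = solve-∀

  module _ (k n : ℕ) where
    private
      N : ℕ
      N = k + suc n + k

    lower-step : suc k * ((suc k + n + suc k) C suc k) ≡ suc N * (N C k)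
    lower-step = trans (cong (λ t → suc k * (t C suc k)) (shape k n)) (absorb N k)

    upper-step : suc (suc (k + n)) * ((suc k + suc n + suc k) C suc k)
               ≡ suc (suc N) * ((suc k + n + suc k) C suc k)
    upper-step = begin
      suc (suc (k + n)) * ((suc k + suc n + suc k) C suc k)
        ≡⟨ cong (λ t → suc (suc (k + n)) * (t C suc k)) (top k n) ⟩
      suc (suc (k + n)) * (suc (suc k + suc (k + n)) C suc k)
        ≡⟨ absorb-co (suc k) (suc (k + n)) ⟩
      suc (suc k + suc (k + n)) * ((suc k + suc (k + n)) C suc k)
        ≡⟨ cong₂ (λ s t → s * (t C suc k)) (outer k n) (bottom k n) ⟨
      suc (suc N) * ((suc k + n + suc k) C suc k)
        ∎
      where
      top : ∀ k n → suc k + suc n + suc k ≡ suc (suc k + suc (k + n))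
      top = solve-∀
      outer : ∀ k n → suc (suc (k + suc n + k)) ≡ suc (suc k + suc (k + n))
      outer = solve-∀
      bottom : ∀ k n → suc k + n + suc k ≡ suc k + suc (k + n)
      bottom = solve-∀

  a-ratio : ∀ k n → suc k * (2 * n + 1) * a (suc k) n ≡ suc n * suc (k + suc n + k) * a k (suc n)
  a-ratio k n = begin
    suc k * (2 * n + 1) * (2 * 2 ^ k * X * W)     ≡⟨ regroup k n (2 ^ k) X W ⟩
    2 ^ k * (2 * suc (n + n) * X) * (suc k * W)   ≡⟨ cong₂ (λ s t → 2 ^ k * s * t) (sym (central n)) (lower-step k n) ⟩
    2 ^ k * (suc n * X') * (suc N * Z)            ≡⟨ regroup' n N (2 ^ k) X' Z ⟩
    suc n * suc N * (2 ^ k * X' * Z)              ∎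
    where
    N X X' Z W : ℕ
    N  = k + suc n + k
    X  = (n + n) C n
    X' = (suc n + suc n) C suc n
    Z  = N C k
    W  = (suc k + n + suc k) C suc k
    regroup : ∀ k n p x w → suc k * (2 * n + 1) * (2 * p * x * w) ≡ p * (2 * suc (n + n) * x) * (suc k * w)
    regroup = solve-∀
    regroup' : ∀ n N p x z → p * (suc n * x) * (suc N * z) ≡ suc n * suc N * (p * x * z)
    regroup' = solve-∀

  a-step : ∀ k n → suc (suc (k + n)) * a (suc k) (suc n)
                 ≡ 4 * suc (k + suc n + k) * a k (suc n) + (4 * n + 2) * a (suc k) n
  a-step k n = *-cancelˡ-≡ _ _ (suc k * suc n) (trans scaled-lhs (sym scaled-rhs))
    where
    N X X' Z W V : ℕ
    N  = k + suc n + k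
    X  = (n + n) C n
    X' = (suc n + suc n) C suc n
    Z  = N C k
    W  = (suc k + n + suc k) C suc k
    V  = (suc k + suc n + suc k) C suc k
    -- both sides, multiplied by (k+1)(n+1), expressed through C(2n, n) and C(2k+n+1, k)
    common : ℕ
    common = 2 * 2 ^ k * (2 * suc (n + n) * X) * suc (suc N) * (suc N * Z)
    scaled-lhs : suc k * suc n * (suc (suc (k + n)) * a (suc k) (suc n)) ≡ common
    scaled-lhs = begin
      suc k * suc n * (suc (suc (k + n)) * (2 * 2 ^ k * X' * V))
        ≡⟨ regroup k n (2 ^ k) X' V ⟩
      2 * 2 ^ k * (suc n * X') * (suc (suc (k + n)) * V) * suc k
        ≡⟨ cong₂ (λ s t → 2 * 2 ^ k * s * t * suc k) (central n) (upper-step k n) ⟩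
      2 * 2 ^ k * (2 * suc (n + n) * X) * (suc (suc N) * W) * suc k
        ≡⟨ regroup' (2 * 2 ^ k * (2 * suc (n + n) * X)) (suc (suc N)) W k ⟩
      2 * 2 ^ k * (2 * suc (n + n) * X) * suc (suc N) * (suc k * W)
        ≡⟨ cong (2 * 2 ^ k * (2 * suc (n + n) * X) * suc (suc N) *_) (lower-step k n) ⟩
      common
        ∎
      where
      regroup : ∀ k n p x v → suc k * suc n * (suc (suc (k + n)) * (2 * p * x * v))
                            ≡ 2 * p * (suc n * x) * (suc (suc (k + n)) * v) * suc k
      regroup = solve-∀
      regroup' : ∀ y M w k → y * (M * w) * suc k ≡ y * M * (suc k * w)
      regroup' = solve-∀
    scaled-rhs : suc k * suc n * (4 * suc N * a k (suc n) + (4 * n + 2) * a (suc k) n) ≡ common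
    scaled-rhs = begin
      suc k * suc n * (4 * suc N * (2 ^ k * X' * Z) + (4 * n + 2) * (2 * 2 ^ k * X * W))
        ≡⟨ regroup k n N (2 ^ k) X X' Z W ⟩
      4 * suc N * suc k * 2 ^ k * (suc n * X') * Z + (4 * n + 2) * suc n * 2 * 2 ^ k * X * (suc k * W)
        ≡⟨ cong₂ (λ s t → 4 * suc N * suc k * 2 ^ k * s * Z + (4 * n + 2) * suc n * 2 * 2 ^ k * X * t)
                 (central n) (lower-step k n) ⟩
      4 * suc N * suc k * 2 ^ k * (2 * suc (n + n) * X) * Z + (4 * n + 2) * suc n * 2 * 2 ^ k * X * (suc N * Z)
        ≡⟨ collect k n (2 ^ k) X Z ⟩
      common
        ∎
      where
      regroup : ∀ k n N p x x' z w →
        suc k * suc n * (4 * suc N * (p * x' * z) + (4 * n + 2) * (2 * p * x * w))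
        ≡ 4 * suc N * suc k * p * (suc n * x') * z + (4 * n + 2) * suc n * 2 * p * x * (suc k * w)
      regroup = solve-∀
      collect : ∀ k n p x z →
        4 * suc (k + suc n + k) * suc k * p * (2 * suc (n + n) * x) * z
          + (4 * n + 2) * suc n * 2 * p * x * (suc (k + suc n + k) * z)
        ≡ 2 * p * (2 * suc (n + n) * x) * suc (suc (k + suc n + k)) * (suc (k + suc n + k) * z)
      collect = solve-∀

  a-step-first : ∀ m → suc m * a 0 (suc m) ≡ (4 * m + 2) * a 0 m
  a-step-first m = begin
    suc m * (1 * ((suc m + suc m) C suc m) * 1)   ≡⟨ unit (suc m) ((suc m + suc m) C suc m) ⟩
    suc m * ((suc m + suc m) C suc m)             ≡⟨ central m ⟩
    2 * suc (m + m) * ((m + m) C m)               ≡⟨ rewrite-coefficient m ((m + m) C m) ⟩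
    (4 * m + 2) * (1 * ((m + m) C m) * 1)         ∎
    where
    unit : ∀ a x → a * (1 * x * 1) ≡ a * x
    unit = solve-∀
    rewrite-coefficient : ∀ m x → 2 * suc (m + m) * x ≡ (4 * m + 2) * (1 * x * 1)
    rewrite-coefficient = solve-∀

  a-step-last : ∀ m → suc m * a (suc m) 0 ≡ 4 * (m + suc m) * a m 0
  a-step-last m = begin
    suc m * (2 * 2 ^ m * 1 * ((suc m + 0 + suc m) C suc m))
      ≡⟨ cong (λ t → suc m * (2 * 2 ^ m * 1 * (t C suc m))) (cong (_+ suc m) (+-identityʳ (suc m))) ⟩
    suc m * (2 * 2 ^ m * 1 * ((suc m + suc m) C suc m))
      ≡⟨ regroup m (2 ^ m) ((suc m + suc m) C suc m) ⟩
    2 * 2 ^ m * (suc m * ((suc m + suc m) C suc m))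
      ≡⟨ cong (2 * 2 ^ m *_) (central m) ⟩
    2 * 2 ^ m * (2 * suc (m + m) * ((m + m) C m))
      ≡⟨ collect m (2 ^ m) ((m + m) C m) ⟩
    4 * (m + suc m) * (2 ^ m * 1 * ((m + m) C m))
      ≡⟨ cong (λ t → 4 * (m + suc m) * (2 ^ m * 1 * (t C m))) (cong (_+ m) (+-identityʳ m)) ⟨
    4 * (m + suc m) * (2 ^ m * 1 * ((m + 0 + m) C m))
      ∎
    where
    regroup : ∀ m p x → suc m * (2 * p * 1 * x) ≡ 2 * p * (suc m * x)
    regroup = solve-∀
    collect : ∀ m p x → 2 * p * (2 * suc (m + m) * x) ≡ 4 * (m + suc m) * (p * 1 * x)
    collect = solve-∀

  c≡a-at : ∀ k n {m} → m ≡ k + n → c k m ≡ a k n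
  c≡a-at k n refl = c≡a k n

  c-step-first : ∀ m → suc m * c 0 (suc m) ≡ (4 * m + 2) * c 0 m
  c-step-first m = begin
    suc m * c 0 (suc m)     ≡⟨ cong (suc m *_) (c≡a 0 (suc m)) ⟩
    suc m * a 0 (suc m)     ≡⟨ a-step-first m ⟩
    (4 * m + 2) * a 0 m     ≡⟨ cong ((4 * m + 2) *_) (c≡a 0 m) ⟨
    (4 * m + 2) * c 0 m     ∎

  c-step : ∀ {k m} → k < m →
    suc m * c (suc k) (suc m) ≡ 4 * (m + suc k) * c k m + (4 * (m ∸ suc k) + 2) * c (suc k) m
  c-step {k} k<m with m≤n⇒∃[o]m+o≡n k<m
  ... | n , refl = begin
    suc m * c (suc k) (suc m)
      ≡⟨ cong (suc m *_) (c≡a-at (suc k) (suc n) (sym (+-suc (suc k) n))) ⟩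
    suc m * a (suc k) (suc n)
      ≡⟨ a-step k n ⟩
    4 * suc (k + suc n + k) * a k (suc n) + (4 * n + 2) * a (suc k) n
      ≡⟨ cong₂ (λ s t → 4 * s * a k (suc n) + (4 * t + 2) * a (suc k) n) (shape k n) (m+n∸m≡n (suc k) n) ⟨
    4 * (m + suc k) * a k (suc n) + (4 * (m ∸ suc k) + 2) * a (suc k) n
      ≡⟨ cong₂ (λ s t → 4 * (m + suc k) * s + (4 * (m ∸ suc k) + 2) * t)
               (c≡a-at k (suc n) (sym (+-suc k n))) (c≡a (suc k) n) ⟨
    4 * (m + suc k) * c k m + (4 * (m ∸ suc k) + 2) * c (suc k) m
      ∎
    where
    m : ℕ
    m = suc k + n

  c-step-last : ∀ m → suc m * c (suc m) (suc m) ≡ 4 * (m + suc m) * c m m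
  c-step-last m = begin
    suc m * c (suc m) (suc m)     ≡⟨ cong (suc m *_) (c≡a-at (suc m) 0 (sym (+-identityʳ (suc m)))) ⟩
    suc m * a (suc m) 0           ≡⟨ a-step-last m ⟩
    4 * (m + suc m) * a m 0       ≡⟨ cong (4 * (m + suc m) *_) (c≡a-at m 0 (sym (+-identityʳ m))) ⟨
    4 * (m + suc m) * c m m       ∎

  c-ratio : ∀ {k m} → k < m →
    suc k * (2 * (m ∸ suc k) + 1) * c (suc k) m ≡ (m ∸ k) * (m + suc k) * c k m
  c-ratio {k} k<m with m≤n⇒∃[o]m+o≡n k<m
  ... | n , refl = begin
    suc k * (2 * (m ∸ suc k) + 1) * c (suc k) m
      ≡⟨ cong₂ (λ s t → suc k * (2 * s + 1) * t) (m+n∸m≡n (suc k) n) (c≡a (suc k) n) ⟩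
    suc k * (2 * n + 1) * a (suc k) n
      ≡⟨ a-ratio k n ⟩
    suc n * suc (k + suc n + k) * a k (suc n)
      ≡⟨ cong₂ (λ s t → s * t * a k (suc n)) (difference k n) (shape k n) ⟨
    (m ∸ k) * (m + suc k) * a k (suc n)
      ≡⟨ cong ((m ∸ k) * (m + suc k) *_) (c≡a-at k (suc n) (sym (+-suc k n))) ⟨
    (m ∸ k) * (m + suc k) * c k m
      ∎
    where
    m : ℕ
    m = suc k + n
    difference : ∀ k n → suc k + n ∸ k ≡ suc n
    difference k n = trans (cong (_∸ k) (sym (+-suc k n))) (m+n∸m≡n k (suc n))

module Sums where

  open import Data.Nat
  open import Data.Nat.Properties
  open import Data.Nat.Combinatorics
  open import Data.Nat.Tactic.RingSolver using (solve-∀)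
  open import Function using (id)
  open import Relation.Binary.PropositionalEquality
  open ≡-Reasoning
  open import Defs using (D)
  open Arithmetic
  open FiniteSums
  open Binomial
  open Weights

  -- S i m = Σ_{k ≤ m} c k m · C(k, i); it equals D i m (terms with k < i vanish).
  S : ℕ → ℕ → ℕ
  S i m = ∑ (suc m) (λ k → c k m * (k C i))

  D≡S : ∀ i m → D i m ≡ S i m
  D≡S i m = trans (sum-applyUpTo (suc m ∸ i) id (λ j → term (i + j)))
                  (sym (∑-dropZeros i (suc m) term below-i))
    where
    term : ℕ → ℕ
    term k = c k m * (k C i)
    below-i : ∀ k → k < i → term k ≡ 0
    below-i k k<i = trans (cong (c k m *_) (k>n⇒nCk≡0 k<i)) (*-zeroʳ (c k m))

  S-vanishes : ∀ m → S (suc m) m ≡ 0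
  S-vanishes m = ∑-zero (suc m) _ (λ k k≤m →
    trans (cong (c k m *_) (k>n⇒nCk≡0 k≤m)) (*-zeroʳ (c k m)))

  S-positive : ∀ i m → i ≤ m → 0 < S i m
  S-positive i m i≤m = <-≤-trans (*-mono-< top-weight (C-pos m i i≤m)) (last≤∑ m (λ k → c k m * (k C i)))
    where
    top-weight : 0 < c m m
    top-weight rewrite c≡a-at m 0 (sym (+-identityʳ m)) =
      *-mono-< (*-mono-< (m^n>0 2 m) z<s) (C-pos (m + 0 + m) m (≤-trans (m≤m+n m 0) (m≤m+n (m + 0) m)))

  -- Passing from m to m + 1 splits every weight c k (m+1) into two weights at m.
  S-step-split : ∀ m i → suc m * S i (suc m) ≡
    ∑ (suc m) (λ k → 4 * (m + suc k) * (c k m * (suc k C i)) + (4 * (m ∸ k) + 2) * (c k m * (k C i)))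
  S-step-split m i = begin
    suc m * S i (suc m)              ≡⟨ ∑-*ˡ (suc (suc m)) (suc m) (λ k → c k (suc m) * (k C i)) ⟨
    ∑ (suc (suc m)) G                ≡⟨ ∑-split m G α β first interior last ⟩
    ∑ (suc m) α + ∑ (suc m) β        ≡⟨ ∑-+ (suc m) α β ⟨
    ∑ (suc m) (λ k → α k + β k)      ∎
    where
    G α β : ℕ → ℕ
    G k = suc m * (c k (suc m) * (k C i))
    α k = 4 * (m + suc k) * (c k m * (suc k C i))
    β k = (4 * (m ∸ k) + 2) * (c k m * (k C i))
    scale : ∀ p x y {q} → p * x ≡ q → p * (x * y) ≡ q * y
    scale p x y eq = trans (sym (*-assoc p x y)) (cong (_* y) eq)
    first : G 0 ≡ β 0
    first = trans (scale (suc m) (c 0 (suc m)) (0 C i) (c-step-first m)) (*-assoc (4 * m + 2) (c 0 m) (0 C i))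
    interior : ∀ k → k < m → G (suc k) ≡ α k + β (suc k)
    interior k k<m = begin
      G (suc k)
        ≡⟨ scale (suc m) (c (suc k) (suc m)) (suc k C i) (c-step k<m) ⟩
      (4 * (m + suc k) * c k m + (4 * (m ∸ suc k) + 2) * c (suc k) m) * (suc k C i)
        ≡⟨ *-distribʳ-+ (suc k C i) (4 * (m + suc k) * c k m) _ ⟩
      4 * (m + suc k) * c k m * (suc k C i) + (4 * (m ∸ suc k) + 2) * c (suc k) m * (suc k C i)
        ≡⟨ cong₂ _+_ (*-assoc (4 * (m + suc k)) (c k m) (suc k C i))
                     (*-assoc (4 * (m ∸ suc k) + 2) (c (suc k) m) (suc k C i)) ⟩
      α k + β (suc k)
        ∎
    last : G (suc m) ≡ α m
    last = trans (scale (suc m) (c (suc m) (suc m)) (suc m C i) (c-step-last m)) (*-assoc (4 * (m + suc m)) (c m m) (suc m C i))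

  m≡k+[m∸k] : ∀ {k m} → k < suc m → m ≡ k + (m ∸ k)
  m≡k+[m∸k] (s≤s k≤m) = sym (m+[n∸m]≡n k≤m)

  S-step-first : ∀ m → suc m * S 0 (suc m) ≡ 2 * (4 * m + 3) * S 0 m
  S-step-first m = begin
    suc m * S 0 (suc m)
      ≡⟨ S-step-split m 0 ⟩
    ∑ (suc m) (λ k → 4 * (m + suc k) * (c k m * 1) + (4 * (m ∸ k) + 2) * (c k m * 1))
      ≡⟨ ∑-cong (suc m) (λ k k≤m → termwise k (m ∸ k) (c k m) (m≡k+[m∸k] k≤m)) ⟩
    ∑ (suc m) (λ k → 2 * (4 * m + 3) * (c k m * (k C 0)))
      ≡⟨ ∑-*ˡ (suc m) (2 * (4 * m + 3)) (λ k → c k m * (k C 0)) ⟩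
    2 * (4 * m + 3) * S 0 m
      ∎
    where
    identity : ∀ k n y → 4 * (k + n + suc k) * (y * 1) + (4 * n + 2) * (y * 1) ≡ 2 * (4 * (k + n) + 3) * (y * 1)
    identity = solve-∀
    termwise : ∀ k n y → m ≡ k + n → 4 * (m + suc k) * (y * 1) + (4 * n + 2) * (y * 1) ≡ 2 * (4 * m + 3) * (y * 1)
    termwise k n y refl = identity k n y

  S-step : ∀ m j → suc m * S (suc j) (suc m) ≡ 4 * (m + suc j) * S j m + 2 * (4 * m + 2 * j + 5) * S (suc j) m
  S-step m j = begin
    suc m * S (suc j) (suc m)
      ≡⟨ S-step-split m (suc j) ⟩
    ∑ (suc m) (λ k → 4 * (m + suc k) * (c k m * (suc k C suc j)) + (4 * (m ∸ k) + 2) * (c k m * (k C suc j)))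
      ≡⟨ ∑-cong (suc m) (λ k k≤m → termwise k (m ∸ k) (c k m) (m≡k+[m∸k] k≤m)) ⟩
    ∑ (suc m) (λ k → 4 * (m + suc j) * (c k m * (k C j)) + 2 * (4 * m + 2 * j + 5) * (c k m * (k C suc j)))
      ≡⟨ ∑-linear (suc m) (4 * (m + suc j)) (2 * (4 * m + 2 * j + 5)) (λ k → c k m * (k C j)) (λ k → c k m * (k C suc j)) ⟩
    4 * (m + suc j) * S j m + 2 * (4 * m + 2 * j + 5) * S (suc j) m
      ∎
    where
    -- the pointwise identity, from Pascal's rule and k·C(k, j) = j·C(k, j) + (j+1)·C(k, j+1)
    identity : ∀ k n j y A B →
      4 * (k + n + suc k) * (y * (A + B)) + (4 * n + 2) * (y * B) + 4 * y * (j * A + suc j * B)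
      ≡ 4 * (k + n + suc j) * (y * A) + 2 * (4 * (k + n) + 2 * j + 5) * (y * B) + 4 * y * (k * A)
    identity = solve-∀
    termwise : ∀ k n y → m ≡ k + n →
      4 * (m + suc k) * (y * (suc k C suc j)) + (4 * n + 2) * (y * (k C suc j))
      ≡ 4 * (m + suc j) * (y * (k C j)) + 2 * (4 * m + 2 * j + 5) * (y * (k C suc j))
    termwise k n y refl = begin
      4 * (m + suc k) * (y * (suc k C suc j)) + (4 * n + 2) * (y * (k C suc j))
        ≡⟨ cong (λ t → 4 * (m + suc k) * (y * t) + (4 * n + 2) * (y * (k C suc j))) (pascal k j) ⟩
      4 * (m + suc k) * (y * (k C j + k C suc j)) + (4 * n + 2) * (y * (k C suc j))
        ≡⟨ combine (identity k n j y (k C j) (k C suc j)) (cong (4 * y *_) (weighted k j)) ⟩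
      4 * (m + suc j) * (y * (k C j)) + 2 * (4 * m + 2 * j + 5) * (y * (k C suc j))
        ∎

  -- Σ_k c k m · k(2(m-k)+1)·C(k-1, j) = Σ_k c k m · (m-k)(m+k+1)·C(k, j):
  -- an index shift k ↦ k + 1 using the ratio of consecutive weights.
  shifted-sums : ∀ m j →
    ∑ (suc m) (λ k → c k m * (k * (2 * (m ∸ k) + 1) * ((k ∸ 1) C j)))
    ≡ ∑ (suc m) (λ k → c k m * ((m ∸ k) * (m + suc k) * (k C j)))
  shifted-sums m j = ∑-shift m (λ k → c k m * (k * (2 * (m ∸ k) + 1) * ((k ∸ 1) C j)))
    (λ k → c k m * ((m ∸ k) * (m + suc k) * (k C j))) (*-zeroʳ (c 0 m)) step top
    where
    swap : ∀ y p x → y * (p * x) ≡ p * y * x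
    swap = solve-∀
    step : ∀ k → k < m →
      c (suc k) m * (suc k * (2 * (m ∸ suc k) + 1) * (k C j)) ≡ c k m * ((m ∸ k) * (m + suc k) * (k C j))
    step k k<m = begin
      c (suc k) m * (suc k * (2 * (m ∸ suc k) + 1) * (k C j))  ≡⟨ swap (c (suc k) m) (suc k * (2 * (m ∸ suc k) + 1)) (k C j) ⟩
      suc k * (2 * (m ∸ suc k) + 1) * c (suc k) m * (k C j)    ≡⟨ cong (_* (k C j)) (c-ratio k<m) ⟩
      (m ∸ k) * (m + suc k) * c k m * (k C j)                  ≡⟨ swap (c k m) ((m ∸ k) * (m + suc k)) (k C j) ⟨
      c k m * ((m ∸ k) * (m + suc k) * (k C j))                ∎
    top : c m m * ((m ∸ m) * (m + suc m) * (m C j)) ≡ 0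
    top = trans (cong (λ t → c m m * (t * (m + suc m) * (m C j))) (n∸n≡0 m)) (*-zeroʳ (c m m))

  -- Three-term recurrence in i, in subtraction-free form:
  -- m(m+1)·S_j + (j+1)(j+2)·S_{j+2} = (j+1)(2m+1)·S_{j+1} + j(j+1)·S_j.
  S-three-term : ∀ m j →
    m * suc m * S j m + suc j * suc (suc j) * S (suc (suc j)) m
    ≡ suc j * (2 * m + 1) * S (suc j) m + j * suc j * S j m
  S-three-term m j = +-cancelʳ-≡ (∑ (suc m) G) _ _ (begin
    α * S j m + β * S (suc (suc j)) m + ∑ (suc m) G
      ≡⟨ cong (α * S j m + β * S (suc (suc j)) m +_) (shifted-sums m j) ⟨
    α * S j m + β * S (suc (suc j)) m + ∑ (suc m) F
      ≡⟨ ∑-combination (suc m) α β y (_C j) (_C suc (suc j)) f ⟨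
    ∑ (suc m) (λ k → y k * (α * (k C j) + β * (k C suc (suc j)) + f k))
      ≡⟨ ∑-cong (suc m) (λ k k≤m → cong (y k *_) (termwise k (m ∸ k) (m≡k+[m∸k] k≤m))) ⟩
    ∑ (suc m) (λ k → y k * (γ * (k C suc j) + δ * (k C j) + g k))
      ≡⟨ ∑-combination (suc m) γ δ y (_C suc j) (_C j) g ⟩
    γ * S (suc j) m + δ * S j m + ∑ (suc m) G
      ∎)
    where
    α β γ δ : ℕ
    α = m * suc m
    β = suc j * suc (suc j)
    γ = suc j * (2 * m + 1)
    δ = j * suc j
    y f g F G : ℕ → ℕ
    y k = c k m
    f k = k * (2 * (m ∸ k) + 1) * ((k ∸ 1) C j)
    g k = (m ∸ k) * (m + suc k) * (k C j)
    F k = y k * f k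
    G k = y k * g k
    identity : ∀ k n j A B C E →
      (k + n) * suc (k + n) * A + suc j * suc (suc j) * C + k * (2 * n + 1) * E
        + ((2 * n + 1) * (suc j * B) + (k + suc j) * (j * A + suc j * B) + suc j * (k * B))
      ≡ suc j * (2 * (k + n) + 1) * B + j * suc j * A + n * (k + n + suc k) * A
        + ((2 * n + 1) * (k * E) + (k + suc j) * (k * A) + suc j * (suc j * B + suc (suc j) * C))
    identity = solve-∀
    -- the pointwise identity, from the absorption and weighted-sum rules for binomials
    termwise : ∀ k n → m ≡ k + n → α * (k C j) + β * (k C suc (suc j)) + k * (2 * n + 1) * ((k ∸ 1) C j)
                                   ≡ γ * (k C suc j) + δ * (k C j) + n * (m + suc k) * (k C j)
    termwise k n refl = combine (identity k n j (k C j) (k C suc j) (k C suc (suc j)) ((k ∸ 1) C j))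
      (cong₂ _+_ (cong₂ _+_ (cong ((2 * n + 1) *_) (absorb-pred k j)) (cong ((k + suc j) *_) (weighted k j)))
                 (cong (suc j *_) (sym (weighted k (suc j)))))

  S-three-term-at : ∀ j r {m} → m ≡ j + r →
    r * (m + suc j) * S j m + suc j * suc (suc j) * S (suc (suc j)) m ≡ suc j * (2 * m + 1) * S (suc j) m
  S-three-term-at j r {m} refl = +-cancelʳ-≡ (j * suc j * S j m) _ _
    (trans (split-square j r (suc j * suc (suc j)) (S j m) (S (suc (suc j)) m)) (S-three-term m j))
    where
    -- m(m+1) = r(m+j+1) + j(j+1)
    split-square : ∀ j r b X Z →
      r * (j + r + suc j) * X + b * Z + j * suc j * X ≡ (j + r) * suc (j + r) * X + b * Z
    split-square = solve-∀

module QuadraticForms where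

  open import Data.Nat
  open import Data.Nat.Properties
  open import Data.List using ([]; _∷_)
  open import Data.Nat.Tactic.RingSolver using (solve; solve-∀)
  open import Data.Product using (_,_)
  open import Relation.Binary.PropositionalEquality

  form : ℕ → ℕ → ℕ → ℕ → ℕ → ℕ
  form A B C Y Z = A * Y * Y + B * Y * Z + C * Z * Z

  form-mono : ∀ {A B C A' B' C'} Y Z → A ≤ A' → B ≤ B' → C < C' → 0 < Z →
    form A B C Y Z < form A' B' C' Y Z
  form-mono Y Z@(suc _) A≤A' B≤B' C<C' _ =
    +-mono-≤-< (+-mono-≤ (*-monoˡ-≤ Y (*-monoˡ-≤ Y A≤A')) (*-monoˡ-≤ Z (*-monoˡ-≤ Y B≤B')))
               (*-monoˡ-< Z (*-monoˡ-< Z C<C'))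

  form-substitute : ∀ A B C p q Y Z u → p * Z + u ≡ q * Y →
    q * q * form A B C Y Z ≡ form A (2 * A * p + B * q) (A * p * p + B * p * q + C * q * q) u Z
  form-substitute A B C p q Y Z u qY = begin
    q * q * (A * Y * Y + B * Y * Z + C * Z * Z)
      ≡⟨ solve (A ∷ B ∷ C ∷ q ∷ Y ∷ Z ∷ []) ⟩
    A * (q * Y) * (q * Y) + B * q * Z * (q * Y) + C * q * q * Z * Z
      ≡⟨ cong (λ t → A * t * t + B * q * Z * t + C * q * q * Z * Z) qY ⟨
    A * (p * Z + u) * (p * Z + u) + B * q * Z * (p * Z + u) + C * q * q * Z * Z
      ≡⟨ solve (A ∷ B ∷ C ∷ p ∷ q ∷ Z ∷ u ∷ []) ⟩
    A * u * u + (2 * A * p + B * q) * u * Z + (A * p * p + B * p * q + C * q * q) * Z * Z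
      ∎
    where open ≡-Reasoning

  form-compare : ∀ A B C A' B' C' p q Y Z → p * Z ≤ q * Y → 0 < Z →
    A ≤ A' →
    2 * A * p + B * q ≤ 2 * A' * p + B' * q →
    A * p * p + B * p * q + C * q * q < A' * p * p + B' * p * q + C' * q * q →
    form A B C Y Z < form A' B' C' Y Z
  form-compare A B C A' B' C' p q Y Z pZ≤qY Z>0 A≤A' B≤B' C<C'
    with m≤n⇒∃[o]m+o≡n pZ≤qY
  ... | u , qY = *-cancelˡ-< (q * q) _ _ (subst₂ _<_
    (sym (form-substitute A B C p q Y Z u qY)) (sym (form-substitute A' B' C' p q Y Z u qY))
    (form-mono u Z A≤A' B≤B' C<C' Z>0))

  -- Five entries of two consecutive rows of a triangle: X, Y, Z in row m at
  -- indices j, j+1, j+2 and U, V in row m+1 at indices j+1, j+2, tied by a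
  -- two-term recurrence in m and a three-term recurrence in j.
  record Configuration : Set where
    field
      M α β γ c₁ c₂ c₃ c₄ X Y Z U V : ℕ
      step-U     : M * U ≡ c₁ * X + c₂ * Y
      step-V     : M * V ≡ c₃ * Y + c₄ * Z
      three-term : α * X + β * Z ≡ γ * Y

  reduce-crossing : (K : Configuration) → let open Configuration K in
    form 0 (c₁ * γ + α * c₂) 0 Y Z < form (α * c₃) (α * c₄) (c₁ * β) Y Z → Z * U < Y * V
  reduce-crossing record { M = M ; α = α ; β = β ; γ = γ ; c₁ = c₁ ; c₂ = c₂ ; c₃ = c₃ ; c₄ = c₄
                         ; X = X ; Y = Y ; Z = Z ; U = U ; V = V
                         ; step-U = step-U ; step-V = step-V ; three-term = three-term } forms< =
    *-cancelˡ-< (M * α) _ _ (+-cancelʳ-< (c₁ * β * Z * Z) _ _ (subst₂ _<_ (sym left) (sym right) forms<))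
    where
    open ≡-Reasoning
    left : M * α * (Z * U) + c₁ * β * Z * Z ≡ form 0 (c₁ * γ + α * c₂) 0 Y Z
    left = begin
      M * α * (Z * U) + c₁ * β * Z * Z
        ≡⟨ solve (M ∷ α ∷ β ∷ c₁ ∷ Z ∷ U ∷ []) ⟩
      α * Z * (M * U) + c₁ * β * Z * Z
        ≡⟨ cong (λ t → α * Z * t + c₁ * β * Z * Z) step-U ⟩
      α * Z * (c₁ * X + c₂ * Y) + c₁ * β * Z * Z
        ≡⟨ solve (α ∷ β ∷ c₁ ∷ c₂ ∷ X ∷ Y ∷ Z ∷ []) ⟩
      c₁ * Z * (α * X + β * Z) + α * c₂ * Y * Z
        ≡⟨ cong (λ t → c₁ * Z * t + α * c₂ * Y * Z) three-term ⟩
      c₁ * Z * (γ * Y) + α * c₂ * Y * Z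
        ≡⟨ solve (α ∷ γ ∷ c₁ ∷ c₂ ∷ Y ∷ Z ∷ []) ⟩
      0 * Y * Y + (c₁ * γ + α * c₂) * Y * Z + 0 * Z * Z
        ∎
    right : M * α * (Y * V) + c₁ * β * Z * Z ≡ form (α * c₃) (α * c₄) (c₁ * β) Y Z
    right = begin
      M * α * (Y * V) + c₁ * β * Z * Z
        ≡⟨ solve (M ∷ α ∷ β ∷ c₁ ∷ Y ∷ Z ∷ V ∷ []) ⟩
      α * Y * (M * V) + c₁ * β * Z * Z
        ≡⟨ cong (λ t → α * Y * t + c₁ * β * Z * Z) step-V ⟩
      α * Y * (c₃ * Y + c₄ * Z) + c₁ * β * Z * Z
        ≡⟨ solve (α ∷ β ∷ c₁ ∷ c₃ ∷ c₄ ∷ Y ∷ Z ∷ []) ⟩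
      α * c₃ * Y * Y + α * c₄ * Y * Z + c₁ * β * Z * Z
        ∎

  reduce-gap : (K : Configuration) → let open Configuration K in
    form (γ * c₃) (γ * c₄ + c₁ * β) 0 Y Z < form (c₁ * γ + α * c₂) (β * c₃) (β * c₄) Y Z → X * V < Y * U
  reduce-gap record { M = M ; α = α ; β = β ; γ = γ ; c₁ = c₁ ; c₂ = c₂ ; c₃ = c₃ ; c₄ = c₄
                    ; X = X ; Y = Y ; Z = Z ; U = U ; V = V
                    ; step-U = step-U ; step-V = step-V ; three-term = three-term } forms< =
    *-cancelˡ-< (M * α) _ _ (+-cancelʳ-< R _ _ (subst₂ _<_ (sym left) (sym right) forms<))
    where
    open ≡-Reasoning
    R : ℕ
    R = (c₁ * β + β * c₃) * Y * Z + β * c₄ * Z * Z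
    left : M * α * (X * V) + R ≡ form (γ * c₃) (γ * c₄ + c₁ * β) 0 Y Z
    left = begin
      M * α * (X * V) + ((c₁ * β + β * c₃) * Y * Z + β * c₄ * Z * Z)
        ≡⟨ solve (M ∷ α ∷ β ∷ c₁ ∷ c₃ ∷ c₄ ∷ X ∷ Y ∷ Z ∷ V ∷ []) ⟩
      α * X * (M * V) + ((c₁ * β + β * c₃) * Y * Z + β * c₄ * Z * Z)
        ≡⟨ cong (λ t → α * X * t + ((c₁ * β + β * c₃) * Y * Z + β * c₄ * Z * Z)) step-V ⟩
      α * X * (c₃ * Y + c₄ * Z) + ((c₁ * β + β * c₃) * Y * Z + β * c₄ * Z * Z)
        ≡⟨ solve (α ∷ β ∷ c₁ ∷ c₃ ∷ c₄ ∷ X ∷ Y ∷ Z ∷ []) ⟩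
      (α * X + β * Z) * (c₃ * Y + c₄ * Z) + c₁ * β * Y * Z
        ≡⟨ cong (λ t → t * (c₃ * Y + c₄ * Z) + c₁ * β * Y * Z) three-term ⟩
      γ * Y * (c₃ * Y + c₄ * Z) + c₁ * β * Y * Z
        ≡⟨ solve (β ∷ γ ∷ c₁ ∷ c₃ ∷ c₄ ∷ Y ∷ Z ∷ []) ⟩
      γ * c₃ * Y * Y + (γ * c₄ + c₁ * β) * Y * Z + 0 * Z * Z
        ∎
    right : M * α * (Y * U) + R ≡ form (c₁ * γ + α * c₂) (β * c₃) (β * c₄) Y Z
    right = begin
      M * α * (Y * U) + ((c₁ * β + β * c₃) * Y * Z + β * c₄ * Z * Z)
        ≡⟨ solve (M ∷ α ∷ β ∷ c₁ ∷ c₃ ∷ c₄ ∷ Y ∷ Z ∷ U ∷ []) ⟩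
      α * Y * (M * U) + ((c₁ * β + β * c₃) * Y * Z + β * c₄ * Z * Z)
        ≡⟨ cong (λ t → α * Y * t + ((c₁ * β + β * c₃) * Y * Z + β * c₄ * Z * Z)) step-U ⟩
      α * Y * (c₁ * X + c₂ * Y) + ((c₁ * β + β * c₃) * Y * Z + β * c₄ * Z * Z)
        ≡⟨ solve (α ∷ β ∷ c₁ ∷ c₂ ∷ c₃ ∷ c₄ ∷ X ∷ Y ∷ Z ∷ []) ⟩
      c₁ * Y * (α * X + β * Z) + α * c₂ * Y * Y + β * c₃ * Y * Z + β * c₄ * Z * Z
        ≡⟨ cong (λ t → c₁ * Y * t + α * c₂ * Y * Y + β * c₃ * Y * Z + β * c₄ * Z * Z) three-term ⟩
      c₁ * Y * (γ * Y) + α * c₂ * Y * Y + β * c₃ * Y * Z + β * c₄ * Z * Z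
        ≡⟨ solve (α ∷ γ ∷ c₁ ∷ c₂ ∷ β ∷ c₃ ∷ c₄ ∷ Y ∷ Z ∷ []) ⟩
      (c₁ * γ + α * c₂) * Y * Y + β * c₃ * Y * Z + β * c₄ * Z * Z
        ∎

  ratio-step : ∀ α β γ p₀ q₀ p₁ q₁ X Y Z → 0 < α * p₁ →
    α * X + β * Z ≡ γ * Y → p₁ * Z ≤ q₁ * Y → β * q₀ * q₁ + α * p₁ * p₀ ≤ q₀ * γ * p₁ →
    p₀ * Y ≤ q₀ * X
  ratio-step α β γ p₀ q₀ p₁ q₁ X Y Z αp₁>0 three-term next coefficients =
    *-cancelˡ-≤ (α * p₁) {{>-nonZero αp₁>0}} (+-cancelʳ-≤ (β * q₀ * q₁ * Y) _ _ (begin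
      α * p₁ * (p₀ * Y) + β * q₀ * q₁ * Y      ≡⟨ solve (α ∷ β ∷ p₀ ∷ q₀ ∷ p₁ ∷ q₁ ∷ Y ∷ []) ⟩
      (β * q₀ * q₁ + α * p₁ * p₀) * Y          ≤⟨ *-monoˡ-≤ Y coefficients ⟩
      q₀ * γ * p₁ * Y                          ≡⟨ solve (γ ∷ q₀ ∷ p₁ ∷ Y ∷ []) ⟩
      p₁ * q₀ * (γ * Y)                        ≡⟨ cong (p₁ * q₀ *_) three-term ⟨
      p₁ * q₀ * (α * X + β * Z)                ≡⟨ solve (α ∷ β ∷ q₀ ∷ p₁ ∷ X ∷ Z ∷ []) ⟩
      α * p₁ * (q₀ * X) + q₀ * β * (p₁ * Z)    ≤⟨ +-monoʳ-≤ (α * p₁ * (q₀ * X)) (*-monoʳ-≤ (q₀ * β) next) ⟩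
      α * p₁ * (q₀ * X) + q₀ * β * (q₁ * Y)    ≡⟨ solve (α ∷ β ∷ q₀ ∷ p₁ ∷ q₁ ∷ X ∷ Y ∷ []) ⟩
      α * p₁ * (q₀ * X) + β * q₀ * q₁ * Y      ∎))
    where open ≤-Reasoning

  -- On the axis Z = 0 only the leading coefficients matter.
  form-compare-axis : ∀ A B C A' B' C' Y Z → Z ≡ 0 → A < A' → 0 < Y → form A B C Y Z < form A' B' C' Y Z
  form-compare-axis A B C A' B' C' Y@(suc _) Z refl A<A' _ =
    subst₂ _<_ (sym (on-axis A B C Y)) (sym (on-axis A' B' C' Y)) (*-monoˡ-< Y (*-monoˡ-< Y A<A'))
    where
    on-axis : ∀ A B C Y → A * Y * Y + B * Y * 0 + C * 0 * 0 ≡ A * Y * Y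
    on-axis = solve-∀

module Polynomials where

  open import Data.Nat
  open import Data.Nat.Properties
  open import Data.Nat.Tactic.RingSolver using (solve-∀)
  open import Data.Bool using (Bool; true; _∧_; T)
  open import Data.Bool.Properties using (T-∧)
  open import Data.List using (List; []; _∷_)
  open import Data.Product using (_,_)
  open import Function.Bundles using (Equivalence)
  open import Relation.Binary.PropositionalEquality

  infixl 6 _⊕_
  infixl 7 _⊗_
  data Expr : Set where
    𝕩 𝕪    : Expr
    con     : ℕ → Expr
    _⊕_ _⊗_ : Expr → Expr → Expr

  ⟦_⟧ : Expr → ℕ → ℕ → ℕ
  ⟦ 𝕩 ⟧     x y = x
  ⟦ 𝕪 ⟧     x y = y
  ⟦ con n ⟧ x y = n
  ⟦ a ⊕ b ⟧ x y = ⟦ a ⟧ x y + ⟦ b ⟧ x y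
  ⟦ a ⊗ b ⟧ x y = ⟦ a ⟧ x y * ⟦ b ⟧ x y

  -- A semiring of coefficients, evaluated at points (x, y), with a sound
  -- (but incomplete) test for pointwise ≤.
  record Coefficients : Set₁ where
    field
      Carrier   : Set
      eval      : Carrier → ℕ → ℕ → ℕ
      zero#     : Carrier
      _+#_ _*#_ : Carrier → Carrier → Carrier
      _≤#_      : Carrier → Carrier → Bool
      eval-zero : ∀ x y → eval zero# x y ≡ 0
      eval-+    : ∀ a b x y → eval (a +# b) x y ≡ eval a x y + eval b x y
      eval-*    : ∀ a b x y → eval (a *# b) x y ≡ eval a x y * eval b x y
      ≤#-sound  : ∀ a b → T (a ≤# b) → ∀ x y → eval a x y ≤ eval b x y

  constants : Coefficients
  constants = record
    { Carrier = ℕ ; eval = λ n _ _ → n ; zero# = 0 ; _+#_ = _+_ ; _*#_ = _*_ ; _≤#_ = _≤ᵇ_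
    ; eval-zero = λ _ _ → refl ; eval-+ = λ _ _ _ _ → refl ; eval-* = λ _ _ _ _ → refl
    ; ≤#-sound = λ a b a≤b _ _ → ≤ᵇ⇒≤ a b a≤b }

  -- Dense polynomials (lists of coefficients, constant term first) in one more
  -- variable v, over a given coefficient semiring; ≤ is tested coefficientwise,
  -- which is sound because the variable only takes non-negative values.
  polynomials : Coefficients → (ℕ → ℕ → ℕ) → Coefficients
  polynomials K v = record
    { Carrier = List Carrier ; eval = evalP ; zero# = [] ; _+#_ = addP ; _*#_ = mulP ; _≤#_ = leP
    ; eval-zero = λ _ _ → refl ; eval-+ = evalP-+ ; eval-* = evalP-* ; ≤#-sound = leP-sound }
    where
    open Coefficients K
    P : Set
    P = List Carrier

    evalP : P → ℕ → ℕ → ℕ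
    evalP []      x y = 0
    evalP (a ∷ p) x y = eval a x y + v x y * evalP p x y

    addP : P → P → P
    addP []      q       = q
    addP (a ∷ p) []      = a ∷ p
    addP (a ∷ p) (b ∷ q) = (a +# b) ∷ addP p q

    scaleP : Carrier → P → P
    scaleP a []      = []
    scaleP a (b ∷ q) = (a *# b) ∷ scaleP a q

    mulP : P → P → P
    mulP []      q = []
    mulP (a ∷ p) q = addP (scaleP a q) (zero# ∷ mulP p q)

    leP : P → P → Bool
    leP []      _       = true
    leP (a ∷ p) []      = (a ≤# zero#) ∧ leP p []
    leP (a ∷ p) (b ∷ q) = (a ≤# b) ∧ leP p q

    evalP-+ : ∀ p q x y → evalP (addP p q) x y ≡ evalP p x y + evalP q x y
    evalP-+ []      q       x y = refl
    evalP-+ (a ∷ p) []      x y = sym (+-identityʳ _)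
    evalP-+ (a ∷ p) (b ∷ q) x y rewrite eval-+ a b x y | evalP-+ p q x y =
      shuffle (eval a x y) (eval b x y) (v x y) (evalP p x y) (evalP q x y)
      where
      shuffle : ∀ a b t u w → a + b + t * (u + w) ≡ a + t * u + (b + t * w)
      shuffle = solve-∀

    evalP-scale : ∀ a q x y → evalP (scaleP a q) x y ≡ eval a x y * evalP q x y
    evalP-scale a []      x y = sym (*-zeroʳ (eval a x y))
    evalP-scale a (b ∷ q) x y rewrite eval-* a b x y | evalP-scale a q x y =
      shuffle (eval a x y) (eval b x y) (v x y) (evalP q x y)
      where
      shuffle : ∀ a b t u → a * b + t * (a * u) ≡ a * (b + t * u)
      shuffle = solve-∀

    evalP-* : ∀ p q x y → evalP (mulP p q) x y ≡ evalP p x y * evalP q x y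
    evalP-* []      q x y = refl
    evalP-* (a ∷ p) q x y
      rewrite evalP-+ (scaleP a q) (zero# ∷ mulP p q) x y | evalP-scale a q x y
            | eval-zero x y | evalP-* p q x y =
      shuffle (eval a x y) (v x y) (evalP p x y) (evalP q x y)
      where
      shuffle : ∀ a t u w → a * w + (0 + t * (u * w)) ≡ (a + t * u) * w
      shuffle = solve-∀

    leP-sound : ∀ p q → T (leP p q) → ∀ x y → evalP p x y ≤ evalP q x y
    leP-sound []      q       _  x y = z≤n
    leP-sound (a ∷ p) []      le x y with Equivalence.to T-∧ le
    ... | a≤0 , p≤0 = subst (evalP (a ∷ p) x y ≤_) (*-zeroʳ (v x y))
      (+-mono-≤ (≤-trans (≤#-sound a zero# a≤0 x y) (≤-reflexive (eval-zero x y)))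
                (*-monoʳ-≤ (v x y) (leP-sound p [] p≤0 x y)))
    leP-sound (a ∷ p) (b ∷ q) le x y with Equivalence.to T-∧ le
    ... | a≤b , p≤q = +-mono-≤ (≤#-sound a b a≤b x y) (*-monoʳ-≤ (v x y) (leP-sound p q p≤q x y))

  bivariate : Coefficients
  bivariate = polynomials (polynomials constants (λ x _ → x)) (λ _ y → y)

  open Coefficients bivariate

  normalize : Expr → Carrier
  normalize 𝕩       = (0 ∷ 1 ∷ []) ∷ []
  normalize 𝕪       = [] ∷ (1 ∷ []) ∷ []
  normalize (con n) = (n ∷ []) ∷ []
  normalize (a ⊕ b) = normalize a +# normalize b
  normalize (a ⊗ b) = normalize a *# normalize b

  normalize-sound : ∀ e x y → eval (normalize e) x y ≡ ⟦ e ⟧ x y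
  normalize-sound 𝕩       x y = variable-x x y
    where
    variable-x : ∀ x y → 0 + x * (1 + x * 0) + y * 0 ≡ x
    variable-x = solve-∀
  normalize-sound 𝕪       x y = variable-y x y
    where
    variable-y : ∀ x y → 0 + y * (1 + x * 0 + y * 0) ≡ y
    variable-y = solve-∀
  normalize-sound (con n) x y = constant n x y
    where
    constant : ∀ n x y → n + x * 0 + y * 0 ≡ n
    constant = solve-∀
  normalize-sound (a ⊕ b) x y =
    trans (eval-+ (normalize a) (normalize b) x y) (cong₂ _+_ (normalize-sound a x y) (normalize-sound b x y))
  normalize-sound (a ⊗ b) x y =
    trans (eval-* (normalize a) (normalize b) x y) (cong₂ _*_ (normalize-sound a x y) (normalize-sound b x y))

  infix 4 _≼_
  record _≼_ (a b : Expr) : Set where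
    constructor pointwise
    field
      at : ∀ x y → ⟦ a ⟧ x y ≤ ⟦ b ⟧ x y

  coefficientwise : ∀ a b → T (normalize a ≤# normalize b) → a ≼ b
  coefficientwise a b a≤b = pointwise λ x y →
    subst₂ _≤_ (normalize-sound a x y) (normalize-sound b x y) (≤#-sound (normalize a) (normalize b) a≤b x y)

module RatioBound where

  open import Data.Nat
  open import Data.Nat.Properties
  open import Relation.Binary.PropositionalEquality
  open Sums
  open QuadraticForms
  open Polynomials

  open _≼_ using (at)

  -- The ratio S_{i+1}(m) / S_i(m) is at most upper r i m / lower i m, where r = m - i.
  lower : ℕ → ℕ → ℕ
  lower i m = suc i * (2 * m + 1) * (m + 3 + i)

  upper : ℕ → ℕ → ℕ → ℕ
  upper r i m = r * (m + suc i) * (2 * m + 2)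

  -- The same quantities, and the coefficients of the three-term recurrence, as
  -- polynomial expressions (they evaluate definitionally to the functions above).
  lowerᴱ : Expr → Expr → Expr
  lowerᴱ i m = (con 1 ⊕ i) ⊗ (con 2 ⊗ m ⊕ con 1) ⊗ (m ⊕ con 3 ⊕ i)

  upperᴱ : Expr → Expr → Expr → Expr
  upperᴱ r i m = r ⊗ (m ⊕ (con 1 ⊕ i)) ⊗ (con 2 ⊗ m ⊕ con 2)

  αᴱ : Expr → Expr → Expr → Expr
  αᴱ r j m = r ⊗ (m ⊕ (con 1 ⊕ j))

  βᴱ : Expr → Expr
  βᴱ j = (con 1 ⊕ j) ⊗ (con 2 ⊕ j)

  γᴱ : Expr → Expr → Expr
  γᴱ j m = (con 1 ⊕ j) ⊗ (con 2 ⊗ m ⊕ con 1)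

  -- Hypotheses of ratio-step for the bound at index i = 𝕩 and m, deduced from
  -- the bound at index i + 1, where m - i = 1 + r'.
  module RatioStep (r' m : Expr) where
    private
      i r α p₀ q₀ p₁ q₁ : Expr
      i  = 𝕩
      r  = con 1 ⊕ r'
      α  = αᴱ r i m
      p₀ = lowerᴱ i m
      q₀ = upperᴱ r i m
      p₁ = lowerᴱ (con 1 ⊕ i) m
      q₁ = upperᴱ r' (con 1 ⊕ i) m

    Positivity : Set
    Positivity = con 1 ≼ α ⊗ p₁

    CoefficientBound : Set
    CoefficientBound = βᴱ i ⊗ q₀ ⊗ q₁ ⊕ α ⊗ p₁ ⊗ p₀ ≼ q₀ ⊗ γᴱ i m ⊗ p₁

  -- The certificates: when m = i + 1 (with r' = 0) and when m = i + 2 + g.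
  base-positive : RatioStep.Positivity (con 0) (𝕩 ⊕ con 1)
  base-positive = coefficientwise _ _ _

  base-coefficients : RatioStep.CoefficientBound (con 0) (𝕩 ⊕ con 1)
  base-coefficients = coefficientwise _ _ _

  step-positive : RatioStep.Positivity (con 1 ⊕ 𝕪) (𝕩 ⊕ (con 2 ⊕ 𝕪))
  step-positive = coefficientwise _ _ _

  step-coefficients : RatioStep.CoefficientBound (con 1 ⊕ 𝕪) (𝕩 ⊕ (con 2 ⊕ 𝕪))
  step-coefficients = coefficientwise _ _ _

  -- Upper bound for consecutive ratios, by downward induction on the index,
  -- starting from S_{m+1}(m) = 0.
  ratio-bound : ∀ i g {m} → m ≡ i + suc g → lower i m * S (suc i) m ≤ upper (suc g) i m * S i m
  ratio-bound i g {m} m≡ = ratio-step (suc g * (m + suc i)) (suc i * suc (suc i)) (suc i * (2 * m + 1))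
    (lower i m) (upper (suc g) i m) (lower (suc i) m) (upper g (suc i) m)
    (S i m) (S (suc i) m) (S (suc (suc i)) m)
    (positive g m≡) (S-three-term-at i (suc g) m≡) (next g m≡) (coefficients g m≡)
    where
    positive : ∀ g {m} → m ≡ i + suc g → 0 < suc g * (m + suc i) * lower (suc i) m
    positive zero    refl = at base-positive i 0
    positive (suc g) refl = at step-positive i g
    coefficients : ∀ g {m} → m ≡ i + suc g →
      suc i * suc (suc i) * upper (suc g) i m * upper g (suc i) m + suc g * (m + suc i) * lower (suc i) m * lower i m
      ≤ upper (suc g) i m * (suc i * (2 * m + 1)) * lower (suc i) m
    coefficients zero    refl = at base-coefficients i 0
    coefficients (suc g) refl = at step-coefficients i g
    next : ∀ g {m} → m ≡ i + suc g → lower (suc i) m * S (suc (suc i)) m ≤ upper g (suc i) m * S (suc i) m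
    next zero    refl = ≤-trans (≤-reflexive (trans (cong (lower (suc i) (i + 1) *_) top) (*-zeroʳ (lower (suc i) (i + 1))))) z≤n
      where
      top : S (suc (suc i)) (i + 1) ≡ 0
      top = trans (cong (λ t → S (suc t) (i + 1)) (+-comm 1 i)) (S-vanishes (i + 1))
    next (suc g) refl = ratio-bound (suc i) g (+-suc i (suc g))

module Inequalities where

  open import Data.Nat
  open import Data.Nat.Properties
  open import Data.Nat.Tactic.RingSolver using (solve-∀)
  open import Data.Product using (_×_; _,_; proj₁; proj₂)
  open import Data.Sum using (inj₁; inj₂)
  open import Relation.Binary.PropositionalEquality
  open Arithmetic
  open Sums
  open QuadraticForms
  open Polynomials
  open RatioBound

  open _≼_ using (at)

  -- The configuration of S around index s + 1 of row m, where m = s + r.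
  configuration : ∀ s r m → m ≡ s + r → Configuration
  configuration s r m m≡ = record
    { M = suc m ; α = r * (m + suc s) ; β = suc s * suc (suc s) ; γ = suc s * (2 * m + 1)
    ; c₁ = 4 * (m + suc s) ; c₂ = 2 * (4 * m + 2 * s + 5)
    ; c₃ = 4 * (m + suc (suc s)) ; c₄ = 2 * (4 * m + 2 * suc s + 5)
    ; X = S s m ; Y = S (suc s) m ; Z = S (suc (suc s)) m
    ; U = S (suc s) (suc m) ; V = S (suc (suc s)) (suc m)
    ; step-U = S-step m s ; step-V = S-step m (suc s) ; three-term = S-three-term-at s r m≡ }

  -- The coefficients of that configuration and of the ratio bound, as
  -- polynomials in s = 𝕩 and an expression m.
  module Coefficientsᴱ (r m : Expr) where
    α β γ c₁ c₂ c₃ c₄ : Expr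
    α  = αᴱ r 𝕩 m
    β  = βᴱ 𝕩
    γ  = γᴱ 𝕩 m
    c₁ = con 4 ⊗ (m ⊕ (con 1 ⊕ 𝕩))
    c₂ = con 2 ⊗ (con 4 ⊗ m ⊕ con 2 ⊗ 𝕩 ⊕ con 5)
    c₃ = con 4 ⊗ (m ⊕ (con 2 ⊕ 𝕩))
    c₄ = con 2 ⊗ (con 4 ⊗ m ⊕ con 2 ⊗ (con 1 ⊕ 𝕩) ⊕ con 5)

  module FormComparison (A B C A' B' C' p q : Expr) where
    Leading Linear Quadratic : Set
    Leading   = A ≼ A'
    Linear    = con 2 ⊗ A ⊗ p ⊕ B ⊗ q ≼ con 2 ⊗ A' ⊗ p ⊕ B' ⊗ q
    Quadratic = con 1 ⊕ (A ⊗ p ⊗ p ⊕ B ⊗ p ⊗ q ⊕ C ⊗ q ⊗ q) ≼ A' ⊗ p ⊗ p ⊕ B' ⊗ p ⊗ q ⊕ C' ⊗ q ⊗ q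

  -- Certificates for an interior index s + 1 of row m = s + 2 + g (s = 𝕩, g = 𝕪).
  module Interior where
    open Coefficientsᴱ (con 2 ⊕ 𝕪) (con 2 ⊕ 𝕩 ⊕ 𝕪)
    p q : Expr
    p = lowerᴱ (con 1 ⊕ 𝕩) (con 2 ⊕ 𝕩 ⊕ 𝕪)
    q = upperᴱ (con 1 ⊕ 𝕪) (con 1 ⊕ 𝕩) (con 2 ⊕ 𝕩 ⊕ 𝕪)

    module Crossing = FormComparison (con 0) (c₁ ⊗ γ ⊕ α ⊗ c₂) (con 0) (α ⊗ c₃) (α ⊗ c₄) (c₁ ⊗ β) p q
    module Gap = FormComparison (γ ⊗ c₃) (γ ⊗ c₄ ⊕ c₁ ⊗ β) (con 0) (c₁ ⊗ γ ⊕ α ⊗ c₂) (β ⊗ c₃) (β ⊗ c₄) p q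

    crossing-linear : Crossing.Linear
    crossing-linear = coefficientwise _ _ _

    crossing-quadratic : Crossing.Quadratic
    crossing-quadratic = coefficientwise _ _ _

    gap-leading : Gap.Leading
    gap-leading = coefficientwise _ _ _

    gap-linear : Gap.Linear
    gap-linear = coefficientwise _ _ _

    gap-quadratic : Gap.Quadratic
    gap-quadratic = coefficientwise _ _ _

  -- Certificate for the last index s + 1 = m of row m = s + 1 (s = 𝕩).
  module Last where
    open Coefficientsᴱ (con 1) (con 1 ⊕ 𝕩)

    gap-leading : con 1 ⊕ γ ⊗ c₃ ≼ c₁ ⊗ γ ⊕ α ⊗ c₂
    gap-leading = coefficientwise _ _ _

  -- Both inequalities at an interior index s + 1 of row m (s + 2 ≤ m), via the
  -- ratio bound S_{s+2}(m)/S_{s+1}(m) ≤ q/p and a comparison of quadratic forms.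
  interior : ∀ s m → suc (suc s) ≤ m →
    (S (suc (suc s)) m * S (suc s) (suc m) < S (suc s) m * S (suc (suc s)) (suc m)) ×
    (S s m * S (suc (suc s)) (suc m) < S (suc s) m * S (suc s) (suc m))
  interior s m s+2≤m with m≤n⇒∃[o]m+o≡n s+2≤m
  ... | g , refl =
    reduce-crossing K (form-compare 0 (c₁ * γ + α * c₂) 0 (α * c₃) (α * c₄) (c₁ * β) p q Y Z bound Z>0
                        z≤n (at Interior.crossing-linear s g) (at Interior.crossing-quadratic s g)) ,
    reduce-gap K (form-compare (γ * c₃) (γ * c₄ + c₁ * β) 0 (c₁ * γ + α * c₂) (β * c₃) (β * c₄) p q Y Z bound Z>0
                   (at Interior.gap-leading s g) (at Interior.gap-linear s g) (at Interior.gap-quadratic s g))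
    where
    K : Configuration
    K = configuration s (suc (suc g)) (suc (suc s) + g) (sym (trans (+-suc s (suc g)) (cong suc (+-suc s g))))
    open Configuration K using (α; β; γ; c₁; c₂; c₃; c₄; Y; Z)
    p q : ℕ
    p = lower (suc s) (suc (suc s) + g)
    q = upper (suc g) (suc s) (suc (suc s) + g)
    bound : p * Z ≤ q * Y
    bound = ratio-bound (suc s) g (cong suc (sym (+-suc s g)))
    Z>0 : 0 < Z
    Z>0 = S-positive (suc (suc s)) (suc (suc s) + g) s+2≤m

  -- The gap inequality at the last index of row m = s + 1, where S_{m+1}(m) = 0.
  gap-last : ∀ s → let m = suc s in S s m * S (suc (suc s)) (suc m) < S (suc s) m * S (suc s) (suc m)
  gap-last s = reduce-gap K (form-compare-axis (γ * c₃) (γ * c₄ + c₁ * β) 0 (c₁ * γ + α * c₂) (β * c₃) (β * c₄)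
    Y Z (S-vanishes (suc s)) (at Last.gap-leading s 0) (S-positive (suc s) (suc s) ≤-refl))
    where
    K : Configuration
    K = configuration s 1 (suc s) (sym (+-comm s 1))
    open Configuration K using (α; β; γ; c₁; c₂; c₃; c₄; Y; Z)

  crossing-first : ∀ m → S 1 m * S 0 (suc m) < S 0 m * S 1 (suc m)
  crossing-first m = *-cancelˡ-< (suc m) _ _ (begin-strict
    suc m * (Y * S 0 (suc m))                  ≡⟨ swap (suc m) Y (S 0 (suc m)) ⟩
    Y * (suc m * S 0 (suc m))                  ≡⟨ cong (Y *_) (S-step-first m) ⟩
    Y * (2 * (4 * m + 3) * X)                  <⟨ dominate m X Y X>0 ⟩
    4 * (m + 1) * X * X + 2 * (4 * m + 5) * X * Y     ≡⟨ regroup m X Y ⟩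
    X * (4 * (m + 1) * X + 2 * (4 * m + 2 * 0 + 5) * Y)  ≡⟨ cong (X *_) (S-step m 0) ⟨
    X * (suc m * S 1 (suc m))                  ≡⟨ swap X (suc m) (S 1 (suc m)) ⟩
    suc m * (X * S 1 (suc m))                  ∎)
    where
    open ≤-Reasoning
    X Y : ℕ
    X = S 0 m
    Y = S 1 m
    X>0 : 0 < X
    X>0 = S-positive 0 m z≤n
    swap : ∀ a b c → a * (b * c) ≡ b * (a * c)
    swap = solve-∀
    regroup : ∀ m X Y → 4 * (m + 1) * X * X + 2 * (4 * m + 5) * X * Y ≡ X * (4 * (m + 1) * X + 2 * (4 * m + 2 * 0 + 5) * Y)
    regroup = solve-∀
    smaller-coefficient : ∀ m X Y → Y * (2 * (4 * m + 3) * X) ≤ 2 * (4 * m + 5) * X * Y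
    smaller-coefficient m X Y = subst₂ _≤_ (arrange-left m X Y) (arrange-right m X Y)
      (*-monoˡ-≤ (X * Y) (*-monoʳ-≤ 2 (+-monoʳ-≤ (4 * m) (s≤s (s≤s (s≤s z≤n))))))
      where
      arrange-left : ∀ m X Y → 2 * (4 * m + 3) * (X * Y) ≡ Y * (2 * (4 * m + 3) * X)
      arrange-left = solve-∀
      arrange-right : ∀ m X Y → 2 * (4 * m + 5) * (X * Y) ≡ 2 * (4 * m + 5) * X * Y
      arrange-right = solve-∀
    dominate : ∀ m X Y → 0 < X → Y * (2 * (4 * m + 3) * X) < 4 * (m + 1) * X * X + 2 * (4 * m + 5) * X * Y
    dominate m X Y X>0 = +-mono-<-≤ square>0 (smaller-coefficient m X Y)
      where
      square>0 : 0 < 4 * (m + 1) * X * X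
      square>0 = *-pos {b = X} (*-pos {b = X} (*-pos {4} {m + 1} z<s (subst (0 <_) (+-comm 1 m) z<s)) X>0) X>0

  -- The crossing inequality at the last index m: its left side vanishes.
  crossing-last : ∀ m → S (suc m) m * S m (suc m) < S m m * S (suc m) (suc m)
  crossing-last m rewrite S-vanishes m = *-pos (S-positive m m ≤-refl) (S-positive (suc m) (suc m) ≤-refl)

  crossing : ∀ m i → i ≤ m → S (suc i) m * S i (suc m) < S i m * S (suc i) (suc m)
  crossing m zero    _       = crossing-first m
  crossing m (suc s) s+1≤m with m≤n⇒m<n∨m≡n s+1≤m
  ... | inj₁ s+2≤m = proj₁ (interior s m s+2≤m)
  ... | inj₂ refl  = crossing-last (suc s)

  gap : ∀ m s → suc s ≤ m → S s m * S (suc (suc s)) (suc m) < S (suc s) m * S (suc s) (suc m)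
  gap m s s+1≤m with m≤n⇒m<n∨m≡n s+1≤m
  ... | inj₁ s+2≤m = proj₂ (interior s m s+2≤m)
  ... | inj₂ refl  = gap-last s

module Rationals where

  open import Data.Nat as ℕ using (ℕ; suc)
  open import Data.Integer as ℤ using (+_; +<+)
  import Data.Integer.Properties as ℤ
  open import Data.Rational using (ℚ; mkℚ; _/_; 0ℚ; _*_; _<_; *<*; Positive)
  import Data.Rational.Properties as ℚ
  open import Data.Nat.Divisibility using (∣1⇒≡1)
  open import Data.Nat.Coprimality using (Coprime)
  open import Data.Product using (_,_)
  open import Relation.Binary.PropositionalEquality
  open import Algebra.Bundles using (CommutativeMonoid)
  open import Algebra.Properties.CommutativeSemigroup
    (CommutativeMonoid.commutativeSemigroup ℚ.*-1-commutativeMonoid) using (interchange)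
  open import Defs using (quarterPow)

  private
    coprime-1 : ∀ x → Coprime x 1
    coprime-1 x (_ , d∣1) = ∣1⇒≡1 d∣1

    embed : ∀ x → + x / 1 ≡ mkℚ (+ x) 0 (coprime-1 x)
    embed x = ℚ.normalize-coprime (coprime-1 x)

  embed-* : ∀ x y → (+ x / 1) * (+ y / 1) ≡ + (x ℕ.* y) / 1
  embed-* x y rewrite embed x | embed y = cong (_/ 1) (sym (ℤ.pos-* x y))

  embed-< : ∀ {x y} → x ℕ.< y → + x / 1 < + y / 1
  embed-< {x} {y} x<y rewrite embed x | embed y =
    *<* (subst₂ ℤ._<_ (sym (ℤ.*-identityʳ (+ x))) (sym (ℤ.*-identityʳ (+ y))) (+<+ x<y))

  quarterPow-positive : ∀ m → Positive (quarterPow m)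
  quarterPow-positive ℕ.zero = _
  quarterPow-positive (suc m) = ℚ.pos*pos⇒pos (+ 1 / 4) (quarterPow m) {{quarterPow-positive m}}

  scaled-< : ∀ x y z w (a b : ℚ) → .{{Positive a}} → .{{Positive b}} → x ℕ.* y ℕ.< z ℕ.* w →
    ((+ x / 1) * a) * ((+ y / 1) * b) < ((+ z / 1) * a) * ((+ w / 1) * b)
  scaled-< x y z w a b xy<zw =
    subst₂ _<_ (sym (interchange (+ x / 1) a (+ y / 1) b)) (sym (interchange (+ z / 1) a (+ w / 1) b))
      (ℚ.*-monoˡ-<-pos (a * b) {{ℚ.pos*pos⇒pos a b}}
        (subst₂ _<_ (sym (embed-* x y)) (sym (embed-* z w)) (embed-< xy<zw)))

  scaled-pos : ∀ z w (a b t : ℚ) → .{{Positive a}} → .{{Positive b}} → 0 ℕ.< z ℕ.* w →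
    0ℚ * t < ((+ z / 1) * a) * ((+ w / 1) * b)
  scaled-pos z w a b t zw>0 = subst (_< _) vanish (scaled-< 0 0 z w a b zw>0)
    where
    vanish : ((+ 0 / 1) * a) * ((+ 0 / 1) * b) ≡ 0ℚ * t
    vanish = trans (cong (_* ((+ 0 / 1) * b)) (ℚ.*-zeroˡ a))
                   (trans (ℚ.*-zeroˡ ((+ 0 / 1) * b)) (sym (ℚ.*-zeroˡ t)))

open import Defs
open import Data.Nat using (ℕ; zero; suc; _≤_)
open import Data.Integer using (+_; _-_)
open import Data.Rational using (0ℚ; _*_; _<_)
open import Data.Product using (_×_; _,_)
import Data.Nat as ℕ
open import Relation.Binary.PropositionalEquality using (sym; cong₂; subst₂)
open Arithmetic using (*-pos)
open Sums using (S; D≡S; S-positive)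
open Inequalities using (crossing; gap)
open Rationals using (scaled-<; scaled-pos; quarterPow-positive)

d-< : ∀ m i j k l → S i m ℕ.* S j (suc m) ℕ.< S k m ℕ.* S l (suc m) →
  d (+ i) m * d (+ j) (suc m) < d (+ k) m * d (+ l) (suc m)
d-< m i j k l lt = scaled-< (D i m) (D j (suc m)) (D k m) (D l (suc m)) (quarterPow m) (quarterPow (suc m))
  {{quarterPow-positive m}} {{quarterPow-positive (suc m)}}
  (subst₂ ℕ._<_ (sym (cong₂ ℕ._*_ (D≡S i m) (D≡S j (suc m)))) (sym (cong₂ ℕ._*_ (D≡S k m) (D≡S l (suc m)))) lt)

d-0< : ∀ m i j t → 0 ℕ.< S i m ℕ.* S j (suc m) → 0ℚ * t < d (+ i) m * d (+ j) (suc m)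
d-0< m i j t pos = scaled-pos (D i m) (D j (suc m)) (quarterPow m) (quarterPow (suc m)) t
  {{quarterPow-positive m}} {{quarterPow-positive (suc m)}}
  (subst₂ (λ x y → 0 ℕ.< x ℕ.* y) (sym (D≡S i m)) (sym (D≡S j (suc m))) pos)

-- The crossing inequality holds at every i ≤ m; the gap inequality has
-- d_{-1}(m) = 0 on the left at i = 0 and is the gap inequality for S otherwise.
theorem1 : (m : ℕ) → 2 ≤ m → (i : ℕ) → i ≤ m →
    (d (+ suc i) m * d (+ i) (suc m) < d (+ i) m * d (+ suc i) (suc m))
    × (d (+ i - + 1) m * d (+ suc i) (suc m) < d (+ i) m * d (+ i) (suc m))
theorem1 m _ i i≤m = d-< m (suc i) i i (suc i) (crossing m i i≤m) , gap-d i i≤m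
  where
  gap-d : ∀ i → i ≤ m → d (+ i - + 1) m * d (+ suc i) (suc m) < d (+ i) m * d (+ i) (suc m)
  gap-d zero    _     = d-0< m 0 0 (d (+ 1) (suc m)) (*-pos (S-positive 0 m ℕ.z≤n) (S-positive 0 (suc m) ℕ.z≤n))
  gap-d (suc s) s+1≤m = d-< m s (suc (suc s)) (suc s) (suc s) (gap m s s+1≤m)
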